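{- Let $\Gamma\neq\mathbb{N}$ be a numerical semigroup. Then for every gap $g\in\mathbb{N}\setminus\Gamma$ one has $W(g)\le W_\Gamma(4)=4\delta(\Gamma)-c(\Gamma)$; that is, $\max_{g\in\mathbb{N}\setminus\Gamma}W(g)\le W_\Gamma(4)$.
   Context: A numerical semigroup is an additive submonoid $\Gamma\subseteq\mathbb{N}$ with finite complement; its elements not in $\Gamma$ are gaps. A $\Gamma$-semimodule is a nonempty subset $\Delta\subseteq\mathbb{Z}$, bounded below, with $\Delta+\Gamma\subseteq\Delta$. For $\Delta\subseteq\mathbb{N}$ with $\mathbb{N}\setminus\Delta$ finite, its conductor $c(\Delta)$ is one more than the largest element of $\mathbb{N}\setminus\Delta$ and $\delta(\Delta)=|\{x\in\Delta: x<c(\Delta)\}|$; in particular this defines $c(\Gamma),\delta(\Gamma)$. $W_\Gamma(k)=k\delta(\Gamma)-c(\Gamma)$. For a gap $g$ of $\Gamma$, let $\Delta_g=\Gamma\cup(g+\Gamma)$ be the $\Gamma$-semimodule minimally generated by $\{0,g\}$, and define the Wilf number of the gap as $W(g)=2\delta(\Delta_g)-c(\Delta_g)$. -}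

module Defs where

open import Data.Nat using (ℕ; zero; suc; _+_; _∸_; _≤_; _≤ᵇ_)
open import Data.Bool using (Bool; true; false; if_then_else_; _∨_; _∧_)
open import Data.Integer as ℤ using (ℤ; +_)
open import Relation.Binary.PropositionalEquality using (_≡_)

Subsetℕ : Set
Subsetℕ = ℕ → Bool

record NumericalSemigroup : Set where
  field
    mem     : Subsetℕ
    zero∈   : mem 0 ≡ true
    closed  : ∀ x y → mem x ≡ true → mem y ≡ true → mem (x + y) ≡ true
    bound   : ℕ
    cofinite : ∀ n → bound ≤ n → mem n ≡ true
open NumericalSemigroup public

-- lastGap P N = 1 + (largest n < N with P n = false), or 0 if none.
-- If all n ≥ N lie in P, this is exactly the conductor of P.
lastGap : Subsetℕ → ℕ → ℕ
lastGap P zero    = zero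
lastGap P (suc n) = if P n then lastGap P n else suc n

countBelow : Subsetℕ → ℕ → ℕ
countBelow P zero    = zero
countBelow P (suc n) = if P n then suc (countBelow P n) else countBelow P n

c : NumericalSemigroup → ℕ
c Γ = lastGap (mem Γ) (bound Γ)

δ : NumericalSemigroup → ℕ
δ Γ = countBelow (mem Γ) (c Γ)

WΓ : NumericalSemigroup → ℕ → ℤ
WΓ Γ k = (+ (k Data.Nat.* δ Γ)) ℤ.- (+ c Γ)

IsGap : NumericalSemigroup → ℕ → Set
IsGap Γ g = mem Γ g ≡ false

Δ : NumericalSemigroup → ℕ → Subsetℕ
Δ Γ g x = mem Γ x ∨ ((g ≤ᵇ x) ∧ mem Γ (x ∸ g))

-- every n ≥ bound Γ + g lies in Δ_g (indeed already in Γ), so this is c(Δ_g)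
cΔ : NumericalSemigroup → ℕ → ℕ
cΔ Γ g = lastGap (Δ Γ g) (bound Γ + g)

δΔ : NumericalSemigroup → ℕ → ℕ
δΔ Γ g = countBelow (Δ Γ g) (cΔ Γ g)

W : NumericalSemigroup → ℕ → ℤ
W Γ g = (+ (2 Data.Nat.* δΔ Γ g)) ℤ.- (+ cΔ Γ g)

-- Let k = |Δ_g ∖ Γ|. Counting elements below a common bound on both sides gives
-- δ(Δ_g) + c(Γ) = δ(Γ) + k + c(Δ_g). As Γ ⊆ Δ_g we have c(Δ_g) ≤ c(Γ), and every new
-- element of Δ_g lies in g + Γ below c(Γ), so k ≤ |Γ ∩ [0, c(Γ) − g)| ≤ δ(Γ). Hence
-- W(g) = 2δ(Γ) + 2k + c(Δ_g) − 2c(Γ) ≤ 4δ(Γ) − c(Γ).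
module Submission where

open import Defs
open import Data.Nat using (ℕ)
open import Data.Integer using (_≤_)

open import Data.Nat as ℕ using (zero; suc; _+_; _*_; _∸_; _≤ᵇ_; _<_; z≤n; s≤s; s≤s⁻¹)
open import Data.Nat.Properties as ℕ
  using (≤-refl; ≤-trans; m≤n⇒m≤1+n; n≤1+n; m≤m+n; m≤n⇒m<n∨m≡n; +-suc; +-comm; +-mono-≤; +-monoʳ-≤)
open import Data.Nat.Tactic.RingSolver using (solve-∀)
import Data.Integer as ℤ
import Data.Integer.Properties as ℤ
open import Data.Bool using (true; false; not; _∧_)
open import Data.Sum using (inj₁; inj₂)
open import Data.Empty using (⊥-elim)
open import Function using (id)
open import Relation.Binary.PropositionalEquality using (_≡_; _≢_; refl; sym; trans; cong; subst; module ≡-Reasoning)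
open import Relation.Nullary using (yes; no)

infix 4 _⊆_
infixl 6 _∖_

_⊆_ : Subsetℕ → Subsetℕ → Set
P ⊆ Q = ∀ x → P x ≡ true → Q x ≡ true

_∖_ : Subsetℕ → Subsetℕ → Subsetℕ
(Q ∖ P) x = not (P x) ∧ Q x

translate : ℕ → Subsetℕ → Subsetℕ
translate g P y = (g ≤ᵇ y) ∧ P (y ∸ g)

translate-+ : ∀ g P x → translate g P (g + x) ≡ P x
translate-+ g P x with g ≤ᵇ g + x | ℕ.≤⇒≤ᵇ (m≤m+n g x)
... | true | _ = cong P (ℕ.m+n∸m≡n g x)

translate-below : ∀ g P x → x < g → translate g P x ≡ false
translate-below g P x x<g with g ≤ᵇ x | ℕ.≤ᵇ⇒≤ g x
... | false | _          = refl
... | true  | g≤ᵇx⇒g≤x = ⊥-elim (ℕ.<⇒≱ x<g (g≤ᵇx⇒g≤x _))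

lastGap≤ : ∀ Q n → lastGap Q n ℕ.≤ n
lastGap≤ Q zero    = z≤n
lastGap≤ Q (suc n) with Q n
... | true  = m≤n⇒m≤1+n (lastGap≤ Q n)
... | false = ≤-refl

lastGap-stable : ∀ {Q m} → (∀ x → m ℕ.≤ x → Q x ≡ true) →
                 ∀ {n} → m ℕ.≤ n → lastGap Q n ≡ lastGap Q m
lastGap-stable above {zero}  z≤n   = refl
lastGap-stable above {suc n} m≤1+n with m≤n⇒m<n∨m≡n m≤1+n
... | inj₂ refl  = refl
... | inj₁ m<1+n rewrite above n (s≤s⁻¹ m<1+n) = lastGap-stable above (s≤s⁻¹ m<1+n)

lastGap≤⇒∈ : ∀ {Q} n x → lastGap Q n ℕ.≤ x → x < n → Q x ≡ true
lastGap≤⇒∈ {Q} (suc n) x lg≤x x<1+n with Q n in Qn | m≤n⇒m<n∨m≡n x<1+n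
... | true  | inj₂ refl = Qn
... | true  | inj₁ x<n  = lastGap≤⇒∈ n x lg≤x (s≤s⁻¹ x<n)
... | false | _         = ⊥-elim (ℕ.<⇒≱ x<1+n lg≤x)

lastGap-antitone : ∀ {Q R} → Q ⊆ R → ∀ n → lastGap R n ℕ.≤ lastGap Q n
lastGap-antitone         Q⊆R zero    = z≤n
lastGap-antitone {Q} {R} Q⊆R (suc n) with Q n in Qn
... | true rewrite Q⊆R n Qn = lastGap-antitone Q⊆R n
... | false = lastGap≤ R (suc n)

countBelow-step : ∀ Q n → countBelow Q n ℕ.≤ countBelow Q (suc n)
countBelow-step Q n with Q n
... | true  = n≤1+n _
... | false = ≤-refl

countBelow-monoʳ : ∀ Q {m n} → m ℕ.≤ n → countBelow Q m ℕ.≤ countBelow Q n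
countBelow-monoʳ Q {n = zero}  z≤n   = ≤-refl
countBelow-monoʳ Q {n = suc n} m≤1+n with m≤n⇒m<n∨m≡n m≤1+n
... | inj₂ refl  = ≤-refl
... | inj₁ m<1+n = ≤-trans (countBelow-monoʳ Q (s≤s⁻¹ m<1+n)) (countBelow-step Q n)

countBelow-mono : ∀ {Q R} → Q ⊆ R → ∀ n → countBelow Q n ℕ.≤ countBelow R n
countBelow-mono         Q⊆R zero    = z≤n
countBelow-mono {Q} {R} Q⊆R (suc n) with Q n in Qn
... | true rewrite Q⊆R n Qn = s≤s (countBelow-mono Q⊆R n)
... | false = ≤-trans (countBelow-mono Q⊆R n) (countBelow-step R n)

countBelow-stable : ∀ {Q m} → (∀ x → m ℕ.≤ x → Q x ≡ false) →
                    ∀ {n} → m ℕ.≤ n → countBelow Q n ≡ countBelow Q m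
countBelow-stable above {zero}  z≤n   = refl
countBelow-stable above {suc n} m≤1+n with m≤n⇒m<n∨m≡n m≤1+n
... | inj₂ refl  = refl
... | inj₁ m<1+n rewrite above n (s≤s⁻¹ m<1+n) = countBelow-stable above (s≤s⁻¹ m<1+n)

countBelow-none : ∀ Q n → (∀ x → x < n → Q x ≡ false) → countBelow Q n ≡ 0
countBelow-none Q zero    _ = refl
countBelow-none Q (suc n) Q↓ rewrite Q↓ n ≤-refl = countBelow-none Q n (λ x x<n → Q↓ x (m≤n⇒m≤1+n x<n))

countBelow-split : ∀ {P Q} → P ⊆ Q → ∀ n → countBelow Q n ≡ countBelow P n + countBelow (Q ∖ P) n
countBelow-split         P⊆Q zero    = refl
countBelow-split {P} {Q} P⊆Q (suc n) with P n in Pn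
... | true rewrite P⊆Q n Pn = cong suc (countBelow-split P⊆Q n)
... | false with Q n
...   | true  = trans (cong suc (countBelow-split P⊆Q n)) (sym (+-suc _ _))
...   | false = countBelow-split P⊆Q n

countBelow-translate : ∀ g P m → countBelow (translate g P) (g + m) ≡ countBelow P m
countBelow-translate g P zero rewrite ℕ.+-identityʳ g =
  countBelow-none (translate g P) g (translate-below g P)
countBelow-translate g P (suc m) rewrite +-suc g m | translate-+ g P m with P m
... | true  = cong suc (countBelow-translate g P m)
... | false = countBelow-translate g P m

countBelow+lastGap : ∀ Q n → countBelow Q n + lastGap Q n ≡ countBelow Q (lastGap Q n) + n
countBelow+lastGap Q zero    = refl
countBelow+lastGap Q (suc n) with Q n in Qn
... | true             = trans (cong suc (countBelow+lastGap Q n)) (sym (+-suc _ n))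
... | false rewrite Qn = refl

countBelow-lastGap-⊆ : ∀ {P Q} → P ⊆ Q → ∀ n →
  countBelow Q (lastGap Q n) + lastGap P n ≡ countBelow P (lastGap P n) + countBelow (Q ∖ P) n + lastGap Q n
countBelow-lastGap-⊆ {P} {Q} P⊆Q n = ℕ.+-cancelʳ-≡ n _ _ (begin
  δQ + cP + n               ≡⟨ swap₁ δQ cP n ⟩
  (δQ + n) + cP             ≡⟨ cong (_+ cP) (countBelow+lastGap Q n) ⟨
  (#Q + cQ) + cP            ≡⟨ cong (λ t → t + cQ + cP) (countBelow-split P⊆Q n) ⟩
  (#P + k) + cQ + cP        ≡⟨ swap₂ #P k cQ cP ⟩
  (#P + cP) + k + cQ        ≡⟨ cong (λ t → t + k + cQ) (countBelow+lastGap P n) ⟩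
  (δP + n) + k + cQ         ≡⟨ swap₃ δP n k cQ ⟩
  δP + k + cQ + n           ∎)
  where
  open ≡-Reasoning
  cP = lastGap P n
  cQ = lastGap Q n
  δP = countBelow P cP
  δQ = countBelow Q cQ
  #P = countBelow P n
  #Q = countBelow Q n
  k  = countBelow (Q ∖ P) n
  swap₁ : ∀ a b c → a + b + c ≡ a + c + b
  swap₁ = solve-∀
  swap₂ : ∀ a b c d → a + b + c + d ≡ a + d + b + c
  swap₂ = solve-∀
  swap₃ : ∀ a b c d → a + b + c + d ≡ a + c + d + b
  swap₃ = solve-∀

lastGap-conductor : ∀ Γ j → lastGap (mem Γ) (bound Γ + j) ≡ c Γ
lastGap-conductor Γ j = lastGap-stable (cofinite Γ) (m≤m+n (bound Γ) j)

conductor≤⇒∈ : ∀ Γ {x} → c Γ ℕ.≤ x → mem Γ x ≡ true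
conductor≤⇒∈ Γ {x} c≤x with x ℕ.<? bound Γ
... | yes x<b = lastGap≤⇒∈ (bound Γ) x c≤x x<b
... | no  x≮b = cofinite Γ x (ℕ.≮⇒≥ x≮b)

gap<conductor : ∀ Γ {g} → IsGap Γ g → g < c Γ
gap<conductor Γ gap = ℕ.≰⇒> λ c≤g → true≢false (trans (sym (conductor≤⇒∈ Γ c≤g)) gap)
  where
  true≢false : true ≢ false
  true≢false ()

Γ⊆Δ : ∀ Γ g → mem Γ ⊆ Δ Γ g
Γ⊆Δ Γ g x x∈Γ rewrite x∈Γ = refl

Δ∖Γ⊆translate : ∀ Γ g → Δ Γ g ∖ mem Γ ⊆ translate g (mem Γ)
Δ∖Γ⊆translate Γ g x with mem Γ x
... | false = id

∣Δ∖Γ∣ : NumericalSemigroup → ℕ → ℕ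
∣Δ∖Γ∣ Γ g = countBelow (Δ Γ g ∖ mem Γ) (bound Γ + g)

cΔ≤c : ∀ Γ g → cΔ Γ g ℕ.≤ c Γ
cΔ≤c Γ g = ≤-trans (lastGap-antitone (Γ⊆Δ Γ g) (bound Γ + g)) (ℕ.≤-reflexive (lastGap-conductor Γ g))

δΔ+c≡δ+∣Δ∖Γ∣+cΔ : ∀ Γ g → δΔ Γ g + c Γ ≡ δ Γ + ∣Δ∖Γ∣ Γ g + cΔ Γ g
δΔ+c≡δ+∣Δ∖Γ∣+cΔ Γ g =
  subst (λ t → δΔ Γ g + t ≡ countBelow (mem Γ) t + ∣Δ∖Γ∣ Γ g + cΔ Γ g)
        (lastGap-conductor Γ g)
        (countBelow-lastGap-⊆ (Γ⊆Δ Γ g) (bound Γ + g))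

∣Δ∖Γ∣≤δ : ∀ Γ {g} → IsGap Γ g → ∣Δ∖Γ∣ Γ g ℕ.≤ δ Γ
∣Δ∖Γ∣≤δ Γ {g} gap = begin
  countBelow (D ∖ P) (bound Γ + g)       ≡⟨ countBelow-stable noneAboveConductor c≤b+g ⟩
  countBelow (D ∖ P) (c Γ)               ≤⟨ countBelow-mono (Δ∖Γ⊆translate Γ g) (c Γ) ⟩
  countBelow (translate g P) (c Γ)       ≡⟨ cong (countBelow (translate g P)) (ℕ.m+[n∸m]≡n g≤c) ⟨
  countBelow (translate g P) (g + c∸g)   ≡⟨ countBelow-translate g P c∸g ⟩
  countBelow P c∸g                       ≤⟨ countBelow-monoʳ P (ℕ.m∸n≤m (c Γ) g) ⟩
  countBelow P (c Γ)                     ∎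
  where
  open ℕ.≤-Reasoning
  P = mem Γ
  D = Δ Γ g
  c∸g = c Γ ∸ g
  g≤c : g ℕ.≤ c Γ
  g≤c = ℕ.<⇒≤ (gap<conductor Γ gap)
  c≤b+g : c Γ ℕ.≤ bound Γ + g
  c≤b+g = ≤-trans (lastGap≤ P (bound Γ)) (m≤m+n (bound Γ) g)
  noneAboveConductor : ∀ x → c Γ ℕ.≤ x → (D ∖ P) x ≡ false
  noneAboveConductor x c≤x = cong (λ b → not b ∧ D x) (conductor≤⇒∈ Γ c≤x)

wilf-arith : ∀ {δ₁ c₁ δ₀ c₀ k} → δ₁ + c₀ ≡ δ₀ + k + c₁ → c₁ ℕ.≤ c₀ → k ℕ.≤ δ₀ →
             c₀ + 2 * δ₁ ℕ.≤ c₁ + 4 * δ₀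
wilf-arith {δ₁} {c₁} {δ₀} {c₀} {k} eq c₁≤c₀ k≤δ₀ = ℕ.+-cancelʳ-≤ c₀ _ _ (begin
  c₀ + 2 * δ₁ + c₀                 ≡⟨ double δ₁ c₀ ⟩
  2 * (δ₁ + c₀)                    ≡⟨ cong (2 *_) eq ⟩
  2 * (δ₀ + k + c₁)                ≡⟨ expand δ₀ k c₁ ⟩
  2 * δ₀ + (k + k) + c₁ + c₁       ≤⟨ +-mono-≤ (ℕ.+-monoˡ-≤ c₁ (+-monoʳ-≤ (2 * δ₀) (+-mono-≤ k≤δ₀ k≤δ₀))) c₁≤c₀ ⟩
  2 * δ₀ + (δ₀ + δ₀) + c₁ + c₀     ≡⟨ collect δ₀ c₁ c₀ ⟩
  c₁ + 4 * δ₀ + c₀                 ∎)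
  where
  open ℕ.≤-Reasoning
  double : ∀ a b → b + 2 * a + b ≡ 2 * (a + b)
  double = solve-∀
  expand : ∀ a b d → 2 * (a + b + d) ≡ 2 * a + (b + b) + d + d
  expand = solve-∀
  collect : ∀ a b d → 2 * a + (a + a) + b + d ≡ b + 4 * a + d
  collect = solve-∀

[+m]-[+n]≤[+o]-[+p] : ∀ m n o p → p + m ℕ.≤ n + o → ℤ.+ m ℤ.- ℤ.+ n ≤ ℤ.+ o ℤ.- ℤ.+ p
[+m]-[+n]≤[+o]-[+p] m n o p p+m≤n+o = begin
  ℤ.+ m ℤ.- ℤ.+ n       ≡⟨ ℤ.[+m]-[+n]≡m⊖n m n ⟩
  m ℤ.⊖ n               ≡⟨ ℤ.+-cancelˡ-⊖ p m n ⟨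
  (p + m) ℤ.⊖ (p + n)   ≤⟨ ℤ.⊖-monoˡ-≤ (p + n) p+m≤n+o ⟩
  (n + o) ℤ.⊖ (p + n)   ≡⟨ cong ((n + o) ℤ.⊖_) (+-comm p n) ⟩
  (n + o) ℤ.⊖ (n + p)   ≡⟨ ℤ.+-cancelˡ-⊖ n o p ⟩
  o ℤ.⊖ p               ≡⟨ ℤ.[+m]-[+n]≡m⊖n o p ⟨
  ℤ.+ o ℤ.- ℤ.+ p       ∎
  where open ℤ.≤-Reasoning

theorem4p2 : (Γ : NumericalSemigroup) → (g : ℕ) → IsGap Γ g → W Γ g ≤ WΓ Γ 4
theorem4p2 Γ g gap = [+m]-[+n]≤[+o]-[+p] (2 * δΔ Γ g) (cΔ Γ g) (4 * δ Γ) (c Γ)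
  (wilf-arith (δΔ+c≡δ+∣Δ∖Γ∣+cΔ Γ g) (cΔ≤c Γ g) (∣Δ∖Γ∣≤δ Γ gap))
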